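{- Let $S$ be a lattice of finite length and let $(L_x)_{x\in S}$ be an $S$-glued system with $S$-glued sum $L$. Let $L'$ be a lattice with join $+$ and meet $\cdot$. For each $x\in S$ let $\phi_x:L_x\to L'$ be a lattice homomorphism. Assume: - for all $x\prec y$ in $S$, $\phi_x$ and $\phi_y$ agree on $L_x\cap L_y$; - for all $x,y\in S$, $$\phi_x(0_x)+\phi_y(0_y)=\phi_{x\vee y}(0_{x\vee y})\quad\text{and}\quad\phi_x(1_x)\cdot\phi_y(1_y)=\phi_{x\wedge y}(1_{x\wedge y}).$$ Then $\phi:=\bigcup_{x\in S}\phi_x$ is a well-defined map $L\to L'$ and a lattice homomorphism. Moreover, $\phi$ is injective if all $\phi_x$ are injective.
   Context: A partially ordered set is of finite length if every chain in it is finite. $S$ has order $\le$, join $\vee$ and meet $\wedge$, and $x\prec y$ means $y$ covers $x$. Each $L_x$ is a lattice of finite length with order $\le_x$, least element $0_x$ and greatest element $1_x$; the underlying sets need not be disjoint. $(L_x)$ is an $S$-glued system if for all $x,y$: (1) if $x\le y$ and $L_x\cap L_y\ne\emptyset$, then $L_x\cap L_y$ is a filter of $L_x$ and an ideal of $L_y$; (2) if $x\le y$, then $a\le_x b\iff a\le_y b$ for $a,b\in L_x\cap L_y$; (3) $x\prec y$ implies $L_x\cap L_y\ne\emptyset$; (4) $L_x\cap L_y\subseteq L_{x\wedge y}\cap L_{x\vee y}$. A filter is a nonempty up-closed subset closed under meets; an ideal is the dual notion. The $S$-glued sum is $L=\bigcup_x L_x$, ordered by the transitive closure of $\bigcup_x\le_x$.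 It is a lattice. -}

module Defs where

open import Level using (Level; _⊔_) renaming (suc to lsuc)
open import Data.Nat using (ℕ)
open import Data.Fin using (Fin)
open import Data.Product using (Σ; ∃; ∃-syntax; _×_; _,_; proj₁)
open import Data.Sum using (_⊎_)
open import Relation.Binary.Core using (Rel)
open import Relation.Binary.PropositionalEquality using (_≡_; _≢_)
open import Relation.Binary.Construct.Closure.Transitive using (TransClosure)
import Relation.Binary.Lattice.Structures as LS
open import Algebra.Core using (Op₂)
import Algebra.Lattice.Bundles as AL

module _ {A : Set} (_≤_ : Rel A Level.zero) where

  IsChain : (A → Set) → Set
  IsChain P = ∀ {a b} → P a → P b → (a ≤ b) ⊎ (b ≤ a)

  IsFiniteSubset : (A → Set) → Set
  IsFiniteSubset P = ∃[ n ] Σ (Fin n → A) λ f →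
    (∀ i → P (f i)) × (∀ a → P a → ∃[ i ] f i ≡ a)

  FiniteLength : Set₁
  FiniteLength = (P : A → Set) → IsChain P → IsFiniteSubset P

  _<_ : A → A → Set
  x < y = (x ≤ y) × (x ≢ y)

  Covers : A → A → Set
  Covers x y = (x < y) × (∀ z → x ≤ z → z ≤ y → (z ≡ x) ⊎ (z ≡ y))

  IsLub : A → A → A → Set
  IsLub a b c = (a ≤ c) × (b ≤ c) × (∀ d → a ≤ d → b ≤ d → c ≤ d)

  IsGlb : A → A → A → Set
  IsGlb a b c = (c ≤ a) × (c ≤ b) × (∀ d → d ≤ a → d ≤ b → d ≤ c)

record FLLattice : Set₁ where
  field
    Carrier   : Set
    _≤_       : Rel Carrier Level.zero
    _∨_       : Op₂ Carrier
    _∧_       : Op₂ Carrier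
    isLattice : LS.IsLattice _≡_ _≤_ _∨_ _∧_
    finiteLength : FiniteLength _≤_

record FLBLattice : Set₁ where
  field
    Carrier   : Set
    _≤_       : Rel Carrier Level.zero
    _∨_       : Op₂ Carrier
    _∧_       : Op₂ Carrier
    𝟙 𝟘       : Carrier
    isBoundedLattice : LS.IsBoundedLattice _≡_ _≤_ _∨_ _∧_ 𝟙 𝟘
    finiteLength : FiniteLength _≤_

module _ (K : FLBLattice) where
  open FLBLattice K

  IsFilter : (Carrier → Set) → Set
  IsFilter F = (∃[ a ] F a)
             × (∀ a b → F a → a ≤ b → F b)
             × (∀ a b → F a → F b → F (a ∧ b))

  IsIdeal : (Carrier → Set) → Set
  IsIdeal I = (∃[ a ] I a)
            × (∀ a b → I b → a ≤ b → I a)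
            × (∀ a b → I a → I b → I (a ∨ b))

-- The lattices L x are possibly overlapping subsets of a common type U:
-- L x has its own carrier, embedded injectively into U by ι x, and
-- "L x ∩ L y" is the set of elements of U lying in both images.

record GluedSystem (S : FLLattice) (U : Set) : Set₁ where
  open FLLattice S renaming (Carrier to |S|; _≤_ to _≤S_; _∨_ to _∨S_; _∧_ to _∧S_)
  open FLBLattice using (Carrier)
  field
    L     : |S| → FLBLattice
    ι     : (x : |S|) → Carrier (L x) → U
    ι-injective : ∀ x {a b} → ι x a ≡ ι x b → a ≡ b

  In : (x y : |S|) → Carrier (L x) → Set
  In x y a = ∃[ b ] ι y b ≡ ι x a

  field
    glue₁ : ∀ x y → x ≤S y → (∃[ a ] In x y a) →
              IsFilter (L x) (In x y) × IsIdeal (L y) (In y x)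
    glue₂ : ∀ x y → x ≤S y → ∀ (a b : Carrier (L x)) (a' b' : Carrier (L y)) →
              ι x a ≡ ι y a' → ι x b ≡ ι y b' →
              (FLBLattice._≤_ (L x) a b → FLBLattice._≤_ (L y) a' b')
              × (FLBLattice._≤_ (L y) a' b' → FLBLattice._≤_ (L x) a b)
    glue₃ : ∀ x y → Covers _≤S_ x y → ∃[ a ] In x y a
    glue₄ : ∀ x y (a : Carrier (L x)) → In x y a →
              In x (x ∧S y) a × In x (x ∨S y) a

  InSum : U → Set
  InSum u = ∃[ x ] ∃[ a ] ι x a ≡ u

  Sum : Set
  Sum = Σ U InSum

  Step : Rel Sum Level.zero
  Step u v = ∃[ x ] ∃[ a ] ∃[ b ]
               (ι x a ≡ proj₁ u) × (ι x b ≡ proj₁ v) × FLBLattice._≤_ (L x) a b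

  _≤Sum_ : Rel Sum Level.zero
  _≤Sum_ = TransClosure Step

module _ {c ℓ : Level} (K : FLBLattice) (L' : AL.Lattice c ℓ) where
  open FLBLattice K
  private module L' = AL.Lattice L'

  IsLatticeHom : (Carrier → L'.Carrier) → Set ℓ
  IsLatticeHom f = (∀ a b → f (a ∨ b) L'.≈ (f a L'.∨ f b))
                 × (∀ a b → f (a ∧ b) L'.≈ (f a L'.∧ f b))

{-# OPTIONS --safe #-}
module Submission where

-- Finite length of S yields excluded middle and hence well-foundedness of < and >, so every
-- s < t is refined by covers and inductions run along covering chains.
-- If s ≤ r ⋖ t, an element a of L s ∩ L t also lies in L r: it lies above 0_t, which lies in the
-- filter L s ∩ L r of L s. As the φ's agree across covers, φ s and φ t agree on L s ∩ L t, and
-- going through L (x ∧ y) any two φ's agree; so Φ is well defined, and it is monotone.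
-- Joining with 0_z moves a ∈ L t into L z when t ≤ z overlap; iterating along a covering chain
-- lifts a ∈ L s to some a↑ ∈ L z above it with φ z a↑ = φ s a ∨ φ z 0_z. Lifting u ∈ L x and
-- v ∈ L y to L (x ∨ y) gives an upper bound m of u and v with Φ m ≤ Φ u ∨ Φ v, because
-- φ (x ∨ y) 0 = φ x 0_x ∨ φ y 0_y; so Φ preserves joins, and meets dually. If all φ x are
-- injective, no proper step u < m of the order has Φ m ≤ Φ u, so Φ u = Φ v forces u = m = v.

open import Defs hiding (_<_)
open import Level using (Level; 0ℓ)
open import Data.Product using (Σ; ∃; _×_; _,_; proj₁; proj₂; map₂)
open import Data.Sum using (_⊎_; inj₁; inj₂; swap)
open import Data.Empty using (⊥-elim)
open import Data.Nat as ℕ using (ℕ; zero; suc; _≤′_; ≤′-refl; ≤′-step)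
import Data.Nat.Properties as ℕ
open import Data.Fin as Fin using (Fin)
open import Data.Fin.Properties using (¬Fin0; ℕ→Fin-notInjective)
open import Function using (_∘_; flip; Injective)
open import Induction.WellFounded using (Acc; acc; WellFounded)
open import Relation.Nullary using (¬_; Dec; yes; no; contradiction)
open import Relation.Nullary.Decidable using (decidable-stable)
open import Relation.Binary.Core using (Rel)
open import Relation.Binary.Structures using (IsPartialOrder)
open import Relation.Binary.Definitions using (tri<; tri≈; tri>)
open import Relation.Binary.PropositionalEquality using (_≡_; refl; sym; trans; cong; subst)
open import Relation.Binary.Construct.Closure.Transitive using ([_]; _∷_; _++_)
import Relation.Binary.Lattice.Structures as LS
import Relation.Binary.Lattice.Bundles as LB
import Relation.Binary.Lattice.Properties.JoinSemilattice as JoinSemilatticeProperties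
import Relation.Binary.Lattice.Properties.MeetSemilattice as MeetSemilatticeProperties
import Relation.Binary.Lattice.Properties.BoundedJoinSemilattice as BoundedJoinSemilatticeProperties
import Relation.Binary.Lattice.Properties.BoundedMeetSemilattice as BoundedMeetSemilatticeProperties
open import Algebra.Lattice.Bundles using (Lattice)
import Algebra.Lattice.Properties.Lattice as LatticeProperties
import Relation.Binary.Reasoning.PartialOrder as PosetReasoning
import Relation.Binary.Construct.Flip.EqAndOrd as Flip
import Relation.Binary.Construct.NonStrictToStrict as NonStrictToStrict

-- IsFiniteSubset does not depend on its order argument; _≤_ only fills that slot.
injective⇒infiniteImage : {A : Set} (_≤_ : Rel A 0ℓ) (s : ℕ → A) → Injective _≡_ _≡_ s →
                          ¬ IsFiniteSubset _≤_ (λ a → ∃ λ n → s n ≡ a)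
injective⇒infiniteImage _ s s-injective (k , f , _ , enumerates) =
  ℕ→Fin-notInjective index (s-injective ∘ f-index-injective)
  where
  index : ℕ → Fin k
  index n = proj₁ (enumerates (s n) (n , refl))

  f∘index : ∀ n → f (index n) ≡ s n
  f∘index n = proj₂ (enumerates (s n) (n , refl))

  f-index-injective : ∀ {m n} → index m ≡ index n → s m ≡ s n
  f-index-injective {m} {n} eq = trans (sym (f∘index m)) (trans (cong f eq) (f∘index n))

finiteLength-flip : {A : Set} {_≤_ : Rel A 0ℓ} → FiniteLength _≤_ → FiniteLength (flip _≤_)
finiteLength-flip finite P isChain = finite P (λ p q → swap (isChain p q))

⋖-flip : {A : Set} {_≤_ : Rel A 0ℓ} {a b : A} → Covers (flip _≤_) b a → Covers _≤_ a b
⋖-flip ((a≤b , b≢a) , between) = (a≤b , b≢a ∘ sym) , λ z a≤z z≤b → swap (between z z≤b a≤z)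

module FiniteLengthPoset {A : Set} {_≤_ : Rel A 0ℓ}
  (isPartialOrder : IsPartialOrder _≡_ _≤_) (finite : FiniteLength _≤_) where

  open IsPartialOrder isPartialOrder using (antisym; ≤-respˡ-≈)
    renaming (refl to ≤-refl; trans to ≤-trans)
  open NonStrictToStrict _≡_ _≤_ using (_<_; <⇒≤; <-irrefl; ≤-<-trans)

  -- The chain {b | b ≡ a × Q} is inhabited iff Q holds, so its enumeration decides Q.
  excludedMiddle : A → (Q : Set) → Dec Q
  excludedMiddle a Q with finite (λ b → b ≡ a × Q) subsingleton
    where
    subsingleton : IsChain _≤_ (λ b → b ≡ a × Q)
    subsingleton (refl , _) (refl , _) = inj₁ ≤-refl
  ... | zero  , _ , _   , enumerates = no λ q → ¬Fin0 (proj₁ (enumerates a (refl , q)))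
  ... | suc _ , _ , inQ , _          = yes (proj₂ (inQ Fin.zero))

  module _ (s : ℕ → A) (descending : ∀ n → s (suc n) < s n) where

    antitone : ∀ {m n} → m ℕ.≤ n → s n ≤ s m
    antitone = go ∘ ℕ.≤⇒≤′
      where
      go : ∀ {m n} → m ≤′ n → s n ≤ s m
      go ≤′-refl      = ≤-refl
      go (≤′-step m≤n) = ≤-trans (<⇒≤ (descending _)) (go m≤n)

    strictlyAntitone : ∀ {m n} → m ℕ.< n → s n < s m
    strictlyAntitone m<n = ≤-<-trans ≤-trans antisym ≤-respˡ-≈ (antitone m<n) (descending _)

    descending-injective : Injective _≡_ _≡_ s
    descending-injective {m} {n} sm≡sn with ℕ.<-cmp m n
    ... | tri< m<n _ _ = ⊥-elim (<-irrefl (sym sm≡sn) (strictlyAntitone m<n))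
    ... | tri≈ _ m≡n _ = m≡n
    ... | tri> _ _ n<m = ⊥-elim (<-irrefl sm≡sn (strictlyAntitone n<m))

    descending-isChain : IsChain _≤_ (λ a → ∃ λ n → s n ≡ a)
    descending-isChain (m , refl) (n , refl) with ℕ.≤-total m n
    ... | inj₁ m≤n = inj₂ (antitone m≤n)
    ... | inj₂ n≤m = inj₁ (antitone n≤m)

  ¬descendingSequence : (s : ℕ → A) → ¬ (∀ n → s (suc n) < s n)
  ¬descendingSequence s descending =
    injective⇒infiniteImage _≤_ s (descending-injective s descending)
      (finite _ (descending-isChain s descending))

  ¬Acc⇒descends : ∀ {a} → ¬ Acc _<_ a → ∃ λ b → b < a × ¬ Acc _<_ b
  ¬Acc⇒descends {a} ¬acc with excludedMiddle a (∃ λ b → b < a × ¬ Acc _<_ b)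
  ... | yes descends = descends
  ... | no ¬descends = contradiction (acc accessible) ¬acc
    where
    accessible : ∀ {b} → b < a → Acc _<_ b
    accessible {b} b<a = decidable-stable (excludedMiddle b (Acc _<_ b))
                           (λ ¬acc-b → ¬descends (b , b<a , ¬acc-b))

  <-wellFounded : WellFounded _<_
  <-wellFounded a = decidable-stable (excludedMiddle a (Acc _<_ a)) λ ¬acc →
    ¬descendingSequence (proj₁ ∘ path ¬acc) (descends ¬acc)
    where
    path : ¬ Acc _<_ a → ℕ → Σ A (¬_ ∘ Acc _<_)
    path ¬acc zero    = a , ¬acc
    path ¬acc (suc n) = map₂ proj₂ (¬Acc⇒descends (proj₂ (path ¬acc n)))

    descends : (¬acc : ¬ Acc _<_ a) → ∀ n → proj₁ (path ¬acc (suc n)) < proj₁ (path ¬acc n)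
    descends ¬acc n = proj₁ (proj₂ (¬Acc⇒descends (proj₂ (path ¬acc n))))

  minimal : (P : A → Set) → ∀ {a} → P a → ∃ λ m → P m × (∀ {b} → P b → b ≤ m → b ≡ m)
  minimal P {a} = go (<-wellFounded a)
    where
    go : ∀ {a} → Acc _<_ a → P a → ∃ λ m → P m × (∀ {b} → P b → b ≤ m → b ≡ m)
    go {a} (acc rs) Pa with excludedMiddle a (∃ λ b → P b × b < a)
    ... | yes (b , Pb , b<a) = go (rs b<a) Pb
    ... | no ¬below = a , Pa , λ {b} Pb b≤a →
      decidable-stable (excludedMiddle a (b ≡ a)) (λ b≢a → ¬below (b , Pb , b≤a , b≢a))

  ≤⇒≡⊎⋖≤ : ∀ {a b} → a ≤ b → a ≡ b ⊎ ∃ λ c → Covers _≤_ a c × c ≤ b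
  ≤⇒≡⊎⋖≤ {a} {b} a≤b with excludedMiddle a (a ≡ b)
  ... | yes a≡b = inj₁ a≡b
  ... | no a≢b with minimal (λ c → a < c × c ≤ b) ((a≤b , a≢b) , ≤-refl)
  ... | c , (a<c , c≤b) , least = inj₂ (c , (a<c , between) , c≤b)
    where
    between : ∀ z → a ≤ z → z ≤ c → z ≡ a ⊎ z ≡ c
    between z a≤z z≤c with excludedMiddle a (z ≡ a)
    ... | yes z≡a = inj₁ z≡a
    ... | no z≢a  = inj₂ (least ((a≤z , z≢a ∘ sym) , ≤-trans z≤c c≤b) z≤c)

≤⇒≡⊎≤⋖ : {A : Set} {_≤_ : Rel A 0ℓ} → IsPartialOrder _≡_ _≤_ → FiniteLength _≤_ →
          ∀ {a b} → a ≤ b → a ≡ b ⊎ ∃ λ c → a ≤ c × Covers _≤_ c b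
≤⇒≡⊎≤⋖ isPartialOrder finite a≤b with Dual.≤⇒≡⊎⋖≤ a≤b
  where
  module Dual = FiniteLengthPoset (Flip.isPartialOrder isPartialOrder) (finiteLength-flip finite)
... | inj₁ b≡a           = inj₁ (sym b≡a)
... | inj₂ (c , b⋖c , a≤c) = inj₂ (c , a≤c , ⋖-flip b⋖c)

module GluedSum {S : FLLattice} {U : Set} (G : GluedSystem S U) where
  open GluedSystem G
  open FLLattice S using (finiteLength)
    renaming (Carrier to |S|; _≤_ to _≤S_; _∨_ to _∨S_; _∧_ to _∧S_; isLattice to isLatticeS)
  open LS.IsLattice isLatticeS using ()
    renaming (isPartialOrder to isPartialOrderS; trans to ≤S-trans;
              x≤x∨y to x≤x∨Sy; y≤x∨y to y≤x∨Sy; x∧y≤x to x∧Sy≤x; x∧y≤y to x∧Sy≤y)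
  open NonStrictToStrict _≡_ _≤S_ using () renaming (_<_ to _<S_)
  open FiniteLengthPoset isPartialOrderS finiteLength using ()
    renaming (<-wellFounded to <S-wellFounded)

  ≤S⇒≡⊎≤⋖ : ∀ {x y} → x ≤S y → x ≡ y ⊎ ∃ λ r → x ≤S r × Covers _≤S_ r y
  ≤S⇒≡⊎≤⋖ = ≤⇒≡⊎≤⋖ isPartialOrderS finiteLength

  private
    Sₗ : LB.Lattice 0ℓ 0ℓ 0ℓ
    Sₗ = record { isLattice = isLatticeS }

  open JoinSemilatticeProperties (LB.Lattice.joinSemilattice Sₗ) using ()
    renaming (x≤y⇒x∨y≈y to x≤y⇒x∨Sy≡y)
  open MeetSemilatticeProperties (LB.Lattice.meetSemilattice Sₗ) using ()
    renaming (y≤x⇒x∧y≈y to y≤x⇒x∧Sy≡y)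

  module Lₓ (x : |S|) where
    open FLBLattice (L x) public using (Carrier; 𝟘; 𝟙)

    boundedLattice : LB.BoundedLattice 0ℓ 0ℓ 0ℓ
    boundedLattice = record { isBoundedLattice = FLBLattice.isBoundedLattice (L x) }

    open LB.BoundedLattice boundedLattice public
      using (_≤_; _∨_; _∧_; minimum; maximum; x≤x∨y; y≤x∨y; x∧y≤x; x∧y≤y)
      renaming (refl to ≤-refl)
    open LB.BoundedLattice boundedLattice
      using (boundedJoinSemilattice; boundedMeetSemilattice; meetSemilattice)
    open BoundedJoinSemilatticeProperties boundedJoinSemilattice public using ()
      renaming (identityʳ to ∨-identityʳ)
    open BoundedMeetSemilatticeProperties boundedMeetSemilattice public using ()
      renaming (identityʳ to ∧-identityʳ)
    open MeetSemilatticeProperties meetSemilattice public using (y≤x⇒x∧y≈y)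

  open Lₓ using (𝟘; 𝟙)

  ∣_∣ : |S| → Set
  ∣ x ∣ = Lₓ.Carrier x

  ⟦_,_⟧ : (x : |S|) → ∣ x ∣ → Sum
  ⟦ x , a ⟧ = ι x a , x , a , refl

  In-sym : ∀ {x y a} (a∈y : In x y a) → In y x (proj₁ a∈y)
  In-sym {a = a} (_ , ιb≡ιa) = a , sym ιb≡ιa

  module _ {x y : |S|} (x≤y : x ≤S y) (x∩y≠∅ : ∃ (In x y)) where

    In-upClosed : ∀ {a b} → In x y a → Lₓ._≤_ x a b → In x y b
    In-upClosed = proj₁ (proj₂ (proj₁ (glue₁ x y x≤y x∩y≠∅))) _ _

    In-downClosed : ∀ {a b} → In y x b → Lₓ._≤_ y a b → In y x a
    In-downClosed = proj₁ (proj₂ (proj₂ (glue₁ x y x≤y x∩y≠∅))) _ _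

    𝟙-In : In x y (𝟙 x)
    𝟙-In = In-upClosed (proj₂ x∩y≠∅) (Lₓ.maximum x _)

    𝟘-In : In y x (𝟘 y)
    𝟘-In = In-downClosed (In-sym (proj₂ x∩y≠∅)) (Lₓ.minimum y _)

  In-convex : ∀ {s r t} {a : ∣ s ∣} → s ≤S r → r ≤S t → ∃ (In r t) → In s t a → In s r a
  In-convex {s} {r} {t} {a} s≤r r≤t r∩t≠∅ a∈t@(b , ιb≡ιa) = In-upClosed s≤r (B , B∈r) B∈r B≤a
    where
    s≤t : s ≤S t
    s≤t = ≤S-trans s≤r r≤t
    𝟘∈s : In t s (𝟘 t)
    𝟘∈s = 𝟘-In s≤t (a , a∈t)
    𝟘∈r : In t r (𝟘 t)
    𝟘∈r = 𝟘-In r≤t r∩t≠∅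
    B : ∣ s ∣
    B = proj₁ 𝟘∈s
    B∈r : In s r B
    B∈r = proj₁ 𝟘∈r , trans (proj₂ 𝟘∈r) (sym (proj₂ 𝟘∈s))
    B≤a : Lₓ._≤_ s B a
    B≤a = proj₂ (glue₂ s t s≤t B a (𝟘 t) b (proj₂ 𝟘∈s) (sym ιb≡ιa)) (Lₓ.minimum t b)

  module _ {c ℓ : Level} (L' : Lattice c ℓ) where
    open Lattice L' using (Carrier; _≈_; _∨_; _∧_)

    module Gluing
      (φ : (x : |S|) → ∣ x ∣ → Carrier)
      (φ-hom : ∀ x → IsLatticeHom (L x) L' (φ x))
      (φ-agrees-⋖ : ∀ x y → Covers _≤S_ x y →
                    ∀ (a : ∣ x ∣) (b : ∣ y ∣) → ι x a ≡ ι y b → φ x a ≈ φ y b)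
      (φ𝟘-∨ : ∀ x y → (φ x (𝟘 x) ∨ φ y (𝟘 y)) ≈ φ (x ∨S y) (𝟘 (x ∨S y)))
      (φ𝟙-∧ : ∀ x y → (φ x (𝟙 x) ∧ φ y (𝟙 y)) ≈ φ (x ∧S y) (𝟙 (x ∧S y)))
      where

      open Lattice L' using (∨-assoc; ∧-assoc; ∨-congˡ; ∨-congʳ; ∧-congˡ; ∧-congʳ)
        renaming (sym to ≈-sym; reflexive to ≈-reflexive)
      open LB.Lattice (LatticeProperties.∨-∧-orderTheoreticLattice L')
        using (_≤_; poset; antisym; x≤x∨y; y≤x∨y; ∨-least; x∧y≤x; x∧y≤y; ∧-greatest;
               joinSemilattice; meetSemilattice)
        renaming (refl to ≤-refl; trans to ≤-trans; reflexive to ≤-reflexive)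
      open JoinSemilatticeProperties joinSemilattice using (∨-monotonic)
      open MeetSemilatticeProperties meetSemilattice using (∧-monotonic)
      open PosetReasoning poset

      φ-∨ : ∀ x (a b : ∣ x ∣) → φ x (Lₓ._∨_ x a b) ≈ φ x a ∨ φ x b
      φ-∨ x = proj₁ (φ-hom x)

      φ-∧ : ∀ x (a b : ∣ x ∣) → φ x (Lₓ._∧_ x a b) ≈ φ x a ∧ φ x b
      φ-∧ x = proj₂ (φ-hom x)

      φ-mono : ∀ x {a b : ∣ x ∣} → Lₓ._≤_ x a b → φ x a ≤ φ x b
      φ-mono x {a} {b} a≤b = begin
        φ x a                ≡⟨ cong (φ x) (Lₓ.y≤x⇒x∧y≈y x a≤b) ⟨
        φ x (Lₓ._∧_ x b a)   ≈⟨ φ-∧ x b a ⟩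
        φ x b ∧ φ x a        ≤⟨ x∧y≤x _ _ ⟩
        φ x b                ∎

      φ-∨𝟘 : ∀ x (a : ∣ x ∣) → φ x a ∨ φ x (𝟘 x) ≈ φ x a
      φ-∨𝟘 x a = begin-equality
        φ x a ∨ φ x (𝟘 x)        ≈⟨ φ-∨ x a (𝟘 x) ⟨
        φ x (Lₓ._∨_ x a (𝟘 x))   ≡⟨ cong (φ x) (Lₓ.∨-identityʳ x a) ⟩
        φ x a                    ∎

      φ-∧𝟙 : ∀ x (a : ∣ x ∣) → φ x a ∧ φ x (𝟙 x) ≈ φ x a
      φ-∧𝟙 x a = begin-equality
        φ x a ∧ φ x (𝟙 x)        ≈⟨ φ-∧ x a (𝟙 x) ⟨
        φ x (Lₓ._∧_ x a (𝟙 x))   ≡⟨ cong (φ x) (Lₓ.∧-identityʳ x a) ⟩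
        φ x a                    ∎

      φ𝟘-absorb : ∀ {x y} → x ≤S y → φ x (𝟘 x) ∨ φ y (𝟘 y) ≈ φ y (𝟘 y)
      φ𝟘-absorb {x} {y} x≤y =
        subst (λ z → φ x (𝟘 x) ∨ φ y (𝟘 y) ≈ φ z (𝟘 z)) (x≤y⇒x∨Sy≡y x≤y) (φ𝟘-∨ x y)

      φ𝟙-absorb : ∀ {x y} → x ≤S y → φ y (𝟙 y) ∧ φ x (𝟙 x) ≈ φ x (𝟙 x)
      φ𝟙-absorb {x} {y} x≤y =
        subst (λ z → φ y (𝟙 y) ∧ φ x (𝟙 x) ≈ φ z (𝟙 z)) (y≤x⇒x∧Sy≡y x≤y) (φ𝟙-∧ y x)

      φ-agrees-≤ : ∀ {s t} → s ≤S t → (a : ∣ s ∣) (b : ∣ t ∣) → ι s a ≡ ι t b → φ s a ≈ φ t b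
      φ-agrees-≤ {t = t} s≤t = go s≤t (<S-wellFounded t)
        where
        go : ∀ {s t} → s ≤S t → Acc _<S_ t →
             (a : ∣ s ∣) (b : ∣ t ∣) → ι s a ≡ ι t b → φ s a ≈ φ t b
        go {s} {t} s≤t (acc rs) a b ιa≡ιb with ≤S⇒≡⊎≤⋖ s≤t
        ... | inj₁ refl = ≈-reflexive (cong (φ s) (ι-injective s ιa≡ιb))
        ... | inj₂ (r , s≤r , r⋖t@((r≤t , _) , _))
          with In-convex s≤r r≤t (glue₃ r t r⋖t) (b , sym ιa≡ιb)
        ... | c , ιc≡ιa = begin-equality
          φ s a   ≈⟨ go s≤r (rs (proj₁ r⋖t)) a c (sym ιc≡ιa) ⟩
          φ r c   ≈⟨ φ-agrees-⋖ r t r⋖t c b (trans ιc≡ιa ιa≡ιb) ⟩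
          φ t b   ∎

      φ-agrees : ∀ {x y} (a : ∣ x ∣) (b : ∣ y ∣) → ι x a ≡ ι y b → φ x a ≈ φ y b
      φ-agrees {x} {y} a b ιa≡ιb with proj₁ (glue₄ x y a (b , sym ιa≡ιb))
      ... | m , ιm≡ιa = begin-equality
        φ x a         ≈⟨ φ-agrees-≤ (x∧Sy≤x x y) m a ιm≡ιa ⟨
        φ (x ∧S y) m  ≈⟨ φ-agrees-≤ (x∧Sy≤y x y) m b (trans ιm≡ιa ιa≡ιb) ⟩
        φ y b         ∎

      Φ : Sum → Carrier
      Φ (_ , x , a , _) = φ x a

      Φ-≈ : ∀ u {x} {a : ∣ x ∣} → ι x a ≡ proj₁ u → Φ u ≈ φ x a
      Φ-≈ (_ , y , b , ιb≡u) ιa≡u = φ-agrees b _ (trans ιb≡u (sym ιa≡u))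

      Step-mono : ∀ {u v} → Step u v → Φ u ≤ Φ v
      Step-mono {u} {v} (x , a , b , ιa≡u , ιb≡v , a≤b) = begin
        Φ u     ≈⟨ Φ-≈ u ιa≡u ⟩
        φ x a   ≤⟨ φ-mono x a≤b ⟩
        φ x b   ≈⟨ Φ-≈ v ιb≡v ⟨
        Φ v     ∎

      Φ-mono : ∀ {u v} → u ≤Sum v → Φ u ≤ Φ v
      Φ-mono {u} {v} [ u≺v ]            = Step-mono {u} {v} u≺v
      Φ-mono {u} (_∷_ {y = w} u≺w w≤v) = ≤-trans (Step-mono {u} {w} u≺w) (Φ-mono w≤v)

      Lift : (s z : |S|) → ∣ s ∣ → Set ℓ
      Lift s z a = Σ ∣ z ∣ λ b → ⟦ s , a ⟧ ≤Sum ⟦ z , b ⟧ × φ z b ≈ φ s a ∨ φ z (𝟘 z)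

      lift-refl : ∀ {s} (a : ∣ s ∣) → Lift s s a
      lift-refl {s} a = a , [ s , a , a , refl , refl , Lₓ.≤-refl s ] , ≈-sym (φ-∨𝟘 s a)

      lift-trans : ∀ {s t z} {a : ∣ s ∣} → t ≤S z →
                   (a↑ : Lift s t a) → Lift t z (proj₁ a↑) → Lift s z a
      lift-trans {s} {t} {z} {a} t≤z (b , a≤b , φb≈) (c , b≤c , φc≈) =
        c , a≤b ++ b≤c , (begin-equality
          φ z c                             ≈⟨ φc≈ ⟩
          φ t b ∨ φ z (𝟘 z)                 ≈⟨ ∨-congʳ φb≈ ⟩
          (φ s a ∨ φ t (𝟘 t)) ∨ φ z (𝟘 z)   ≈⟨ ∨-assoc _ _ _ ⟩
          φ s a ∨ (φ t (𝟘 t) ∨ φ z (𝟘 z))   ≈⟨ ∨-congˡ (φ𝟘-absorb t≤z) ⟩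
          φ s a ∨ φ z (𝟘 z)                 ∎)

      lift-step : ∀ {t z} → t ≤S z → ∃ (In t z) → (a : ∣ t ∣) → Lift t z a
      lift-step {t} {z} t≤z t∩z≠∅ a with 𝟘-In t≤z t∩z≠∅
      ... | B , ιB≡ι𝟘 with In-upClosed t≤z t∩z≠∅ (𝟘 z , sym ιB≡ι𝟘) (Lₓ.y≤x∨y t a B)
      ... | b , ιb≡ιa∨B =
        b , [ t , a , Lₓ._∨_ t a B , refl , sym ιb≡ιa∨B , Lₓ.x≤x∨y t a B ] , (begin-equality
          φ z b                ≈⟨ φ-agrees b _ ιb≡ιa∨B ⟩
          φ t (Lₓ._∨_ t a B)   ≈⟨ φ-∨ t a B ⟩
          φ t a ∨ φ t B        ≈⟨ ∨-congˡ (φ-agrees B _ ιB≡ι𝟘) ⟩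
          φ t a ∨ φ z (𝟘 z)    ∎)

      lift : ∀ {s z} → s ≤S z → (a : ∣ s ∣) → Lift s z a
      lift {z = z} s≤z = go s≤z (<S-wellFounded z)
        where
        go : ∀ {s z} → s ≤S z → Acc _<S_ z → (a : ∣ s ∣) → Lift s z a
        go {z = z} s≤z (acc rs) a with ≤S⇒≡⊎≤⋖ s≤z
        ... | inj₁ refl = lift-refl a
        ... | inj₂ (t , s≤t , t⋖z@((t≤z , _) , _)) =
          lift-trans t≤z (go s≤t (rs (proj₁ t⋖z)) a) (lift-step t≤z (glue₃ t z t⋖z) _)

      Lower : (z s : |S|) → ∣ s ∣ → Set ℓ
      Lower z s a = Σ ∣ z ∣ λ b → ⟦ z , b ⟧ ≤Sum ⟦ s , a ⟧ × φ z b ≈ φ s a ∧ φ z (𝟙 z)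

      lower-refl : ∀ {s} (a : ∣ s ∣) → Lower s s a
      lower-refl {s} a = a , [ s , a , a , refl , refl , Lₓ.≤-refl s ] , ≈-sym (φ-∧𝟙 s a)

      lower-trans : ∀ {z t s} {a : ∣ s ∣} → z ≤S t →
                    (a↓ : Lower t s a) → Lower z t (proj₁ a↓) → Lower z s a
      lower-trans {z} {t} {s} {a} z≤t (b , b≤a , φb≈) (c , c≤b , φc≈) =
        c , c≤b ++ b≤a , (begin-equality
          φ z c                             ≈⟨ φc≈ ⟩
          φ t b ∧ φ z (𝟙 z)                 ≈⟨ ∧-congʳ φb≈ ⟩
          (φ s a ∧ φ t (𝟙 t)) ∧ φ z (𝟙 z)   ≈⟨ ∧-assoc _ _ _ ⟩
          φ s a ∧ (φ t (𝟙 t) ∧ φ z (𝟙 z))   ≈⟨ ∧-congˡ (φ𝟙-absorb z≤t) ⟩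
          φ s a ∧ φ z (𝟙 z)                 ∎)

      lower-step : ∀ {t s} → t ≤S s → ∃ (In t s) → (a : ∣ s ∣) → Lower t s a
      lower-step {t} {s} t≤s t∩s≠∅ a with 𝟙-In t≤s t∩s≠∅
      ... | T , ιT≡ι𝟙 with In-downClosed t≤s t∩s≠∅ (𝟙 t , sym ιT≡ι𝟙) (Lₓ.x∧y≤y s a T)
      ... | b , ιb≡ιa∧T =
        b , [ s , Lₓ._∧_ s a T , a , sym ιb≡ιa∧T , refl , Lₓ.x∧y≤x s a T ] , (begin-equality
          φ t b                ≈⟨ φ-agrees b _ ιb≡ιa∧T ⟩
          φ s (Lₓ._∧_ s a T)   ≈⟨ φ-∧ s a T ⟩
          φ s a ∧ φ s T        ≈⟨ ∧-congˡ (φ-agrees T _ ιT≡ι𝟙) ⟩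
          φ s a ∧ φ t (𝟙 t)    ∎)

      lower : ∀ {z s} → z ≤S s → (a : ∣ s ∣) → Lower z s a
      lower {s = s} z≤s = go z≤s (<S-wellFounded s)
        where
        go : ∀ {z s} → z ≤S s → Acc _<S_ s → (a : ∣ s ∣) → Lower z s a
        go {s = s} z≤s (acc rs) a with ≤S⇒≡⊎≤⋖ z≤s
        ... | inj₁ refl = lower-refl a
        ... | inj₂ (t , z≤t , t⋖s@((t≤s , _) , _)) =
          let a↓ = lower-step t≤s (glue₃ t s t⋖s) a
          in  lower-trans z≤t a↓ (go z≤t (rs (proj₁ t⋖s)) (proj₁ a↓))

      upperBound : ∀ u v → ∃ λ m → u ≤Sum m × v ≤Sum m × Φ m ≤ Φ u ∨ Φ v
      upperBound (_ , x , a , refl) (_ , y , b , refl)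
        with lift (x≤x∨Sy x y) a | lift (y≤x∨Sy x y) b
      ... | a↑ , a≤a↑ , φa↑≈ | b↑ , b≤b↑ , φb↑≈ =
        ⟦ z , Lₓ._∨_ z a↑ b↑ ⟧ ,
        a≤a↑ ++ [ z , a↑ , Lₓ._∨_ z a↑ b↑ , refl , refl , Lₓ.x≤x∨y z a↑ b↑ ] ,
        b≤b↑ ++ [ z , b↑ , Lₓ._∨_ z a↑ b↑ , refl , refl , Lₓ.y≤x∨y z a↑ b↑ ] ,
        (begin
          φ z (Lₓ._∨_ z a↑ b↑)   ≈⟨ φ-∨ z a↑ b↑ ⟩
          φ z a↑ ∨ φ z b↑        ≤⟨ ∨-least (below φa↑≈ (x≤x∨y _ _)) (below φb↑≈ (y≤x∨y _ _)) ⟩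
          φ x a ∨ φ y b          ∎)
        where
        z = x ∨S y
        φ𝟘≤ : φ z (𝟘 z) ≤ φ x a ∨ φ y b
        φ𝟘≤ = begin
          φ z (𝟘 z)               ≈⟨ φ𝟘-∨ x y ⟨
          φ x (𝟘 x) ∨ φ y (𝟘 y)   ≤⟨ ∨-monotonic (φ-mono x (Lₓ.minimum x a))
                                                 (φ-mono y (Lₓ.minimum y b)) ⟩
          φ x a ∨ φ y b           ∎
        below : ∀ {c p} → φ z c ≈ p ∨ φ z (𝟘 z) → p ≤ φ x a ∨ φ y b → φ z c ≤ φ x a ∨ φ y b
        below φc≈ p≤ = ≤-trans (≤-reflexive φc≈) (∨-least p≤ φ𝟘≤)

      lowerBound : ∀ u v → ∃ λ m → m ≤Sum u × m ≤Sum v × Φ u ∧ Φ v ≤ Φ m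
      lowerBound (_ , x , a , refl) (_ , y , b , refl)
        with lower (x∧Sy≤x x y) a | lower (x∧Sy≤y x y) b
      ... | a↓ , a↓≤a , φa↓≈ | b↓ , b↓≤b , φb↓≈ =
        ⟦ z , Lₓ._∧_ z a↓ b↓ ⟧ ,
        [ z , Lₓ._∧_ z a↓ b↓ , a↓ , refl , refl , Lₓ.x∧y≤x z a↓ b↓ ] ++ a↓≤a ,
        [ z , Lₓ._∧_ z a↓ b↓ , b↓ , refl , refl , Lₓ.x∧y≤y z a↓ b↓ ] ++ b↓≤b ,
        (begin
          φ x a ∧ φ y b          ≤⟨ ∧-greatest (above φa↓≈ (x∧y≤x _ _)) (above φb↓≈ (x∧y≤y _ _)) ⟩
          φ z a↓ ∧ φ z b↓        ≈⟨ φ-∧ z a↓ b↓ ⟨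
          φ z (Lₓ._∧_ z a↓ b↓)   ∎)
        where
        z = x ∧S y
        ≤φ𝟙 : φ x a ∧ φ y b ≤ φ z (𝟙 z)
        ≤φ𝟙 = begin
          φ x a ∧ φ y b           ≤⟨ ∧-monotonic (φ-mono x (Lₓ.maximum x a))
                                                 (φ-mono y (Lₓ.maximum y b)) ⟩
          φ x (𝟙 x) ∧ φ y (𝟙 y)   ≈⟨ φ𝟙-∧ x y ⟩
          φ z (𝟙 z)               ∎
        above : ∀ {c p} → φ z c ≈ p ∧ φ z (𝟙 z) → φ x a ∧ φ y b ≤ p → φ x a ∧ φ y b ≤ φ z c
        above φc≈ ≤p = ≤-trans (∧-greatest ≤p ≤φ𝟙) (≤-reflexive (≈-sym φc≈))

      Φ-∨ : ∀ u v w → IsLub _≤Sum_ u v w → Φ w ≈ Φ u ∨ Φ v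
      Φ-∨ u v w (u≤w , v≤w , least) with upperBound u v
      ... | m , u≤m , v≤m , Φm≤ =
        antisym (≤-trans (Φ-mono (least m u≤m v≤m)) Φm≤) (∨-least (Φ-mono u≤w) (Φ-mono v≤w))

      Φ-∧ : ∀ u v w → IsGlb _≤Sum_ u v w → Φ w ≈ Φ u ∧ Φ v
      Φ-∧ u v w (w≤u , w≤v , greatest) with lowerBound u v
      ... | m , m≤u , m≤v , ≤Φm =
        antisym (∧-greatest (Φ-mono w≤u) (Φ-mono w≤v)) (≤-trans ≤Φm (Φ-mono (greatest m m≤u m≤v)))

      module _ (φ-injective : ∀ x (a b : ∣ x ∣) → φ x a ≈ φ x b → a ≡ b) where

        ≤Sum-rigid : ∀ {u v} → u ≤Sum v → Φ v ≤ Φ u → proj₁ u ≡ proj₁ v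
        ≤Sum-rigid {u} {v} [ x , a , b , ιa≡u , ιb≡v , a≤b ] Φv≤Φu =
          trans (sym ιa≡u) (trans (cong (ι x) a≡b) ιb≡v)
          where
          φb≤φa : φ x b ≤ φ x a
          φb≤φa = begin
            φ x b   ≈⟨ Φ-≈ v ιb≡v ⟨
            Φ v     ≤⟨ Φv≤Φu ⟩
            Φ u     ≈⟨ Φ-≈ u ιa≡u ⟩
            φ x a   ∎
          a≡b : a ≡ b
          a≡b = φ-injective x a b (antisym (φ-mono x a≤b) φb≤φa)
        ≤Sum-rigid {u} (_∷_ {y = w} u≺w w≤v) Φv≤Φu =
          trans (≤Sum-rigid {u} {w} [ u≺w ] (≤-trans (Φ-mono w≤v) Φv≤Φu))
                (≤Sum-rigid w≤v (≤-trans Φv≤Φu (Φ-mono {u} {w} [ u≺w ])))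

        Φ-injective : ∀ u v → Φ u ≈ Φ v → proj₁ u ≡ proj₁ v
        Φ-injective u v Φu≈Φv with upperBound u v
        ... | m , u≤m , v≤m , Φm≤ =
          trans (≤Sum-rigid u≤m (≤-trans Φm≤ (∨-least ≤-refl (≤-reflexive (≈-sym Φu≈Φv)))))
                (sym (≤Sum-rigid v≤m (≤-trans Φm≤ (∨-least (≤-reflexive Φu≈Φv) ≤-refl))))

theorem5p1 : {c ℓ : Level} (S : FLLattice) (U : Set) (G : GluedSystem S U)
  (L' : Lattice c ℓ) →
  let open GluedSystem G
      module S = FLLattice S
      module L' = Lattice L'
      module Lx = FLBLattice
  in (φ : (x : S.Carrier) → Lx.Carrier (L x) → L'.Carrier) →
  (∀ x → IsLatticeHom (L x) L' (φ x)) →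
  (∀ x y → Covers S._≤_ x y → ∀ (a : Lx.Carrier (L x)) (b : Lx.Carrier (L y)) →
    ι x a ≡ ι y b → φ x a L'.≈ φ y b) →
  (∀ x y → (φ x (Lx.𝟘 (L x)) L'.∨ φ y (Lx.𝟘 (L y)))
             L'.≈ φ (x S.∨ y) (Lx.𝟘 (L (x S.∨ y)))) →
  (∀ x y → (φ x (Lx.𝟙 (L x)) L'.∧ φ y (Lx.𝟙 (L y)))
             L'.≈ φ (x S.∧ y) (Lx.𝟙 (L (x S.∧ y)))) →
  Σ (Sum → L'.Carrier) λ Φ →
    (∀ x (a : Lx.Carrier (L x)) (p : InSum (ι x a)) → Φ (ι x a , p) L'.≈ φ x a)
    × (∀ u v w → IsLub _≤Sum_ u v w → Φ w L'.≈ (Φ u L'.∨ Φ v))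
    × (∀ u v w → IsGlb _≤Sum_ u v w → Φ w L'.≈ (Φ u L'.∧ Φ v))
    × ((∀ x (a b : Lx.Carrier (L x)) → φ x a L'.≈ φ x b → a ≡ b) →
       ∀ (u v : Sum) → Φ u L'.≈ Φ v → proj₁ u ≡ proj₁ v)
theorem5p1 _ _ G L' φ φ-hom φ-agrees-⋖ φ𝟘-∨ φ𝟙-∧ =
  Φ , (λ x a p → Φ-≈ (ι x a , p) refl) , Φ-∨ , Φ-∧ , Φ-injective
  where
  open GluedSystem G using (ι)
  open GluedSum.Gluing G L' φ φ-hom φ-agrees-⋖ φ𝟘-∨ φ𝟙-∧
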